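{- Let $n$ be a nonsquare positive integer and consider the (nondeterministic) chakravala step algorithm below. If the algorithm produces exactly one sequence, then this sequence is finite and of the form $$(1,m_0,k_1),(k_1,m_1,k_2),\dots,(k_2,m_1,k_1),(k_1,m_0,1);$$ that is, writing it as $(k_j,m_j,k_{j+1})_{0\le j\le N}$ with $k_0=k_{N+1}=1$, one has $(k_{N-j},m_{N-j},k_{N-j+1})=(k_{j+1},m_j,k_j)$ for all $0\le j\le N$.
   Context: Throughout, $n$ is a fixed nonsquare positive integer. A positive integer $m$ is best mod $k$ if for every positive integer $m'\equiv m\pmod k$, $|m^2-n|\le|m'^2-n|$ (there may be one or two such $m$ in a given congruence class). A step is a triple $(k,m,k')$ of positive integers with $k<\sqrt n$, $|m^2-n|=kk'$ and $m$ best mod $k$. The algorithm: set $m_{ -1}=0$, $k_0=1$; at stage $i=0,1,2,\dots$, choose $m_i$ with $m_i\equiv -m_{i-1}\pmod{k_i}$ and $m_i$ best mod $k_i$ (any of the possible choices), set $k_{i+1}=|m_i^2-n|/k_i$, so that $(k_i,m_i,k_{i+1})$ is a step; if $k_{i+1}=1$ stop, otherwise go to stage $i+1$. A sequence produced by the algorithm is the (finite or infinite) sequence of steps $(k_0,m_0,k_1),(k_1,m_1,k_2),\dots$ obtained by some run of the algorithm, over all possible choices. -}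

module Defs where

open import Data.Nat using (ℕ; zero; suc; _+_; _*_; _≤_; _<_; ∣_-_∣)
open import Data.Nat.Divisibility using (_∣_)
open import Data.Product using (Σ; _×_; _,_; proj₁; proj₂)
open import Data.List using (List; []; _∷_; length; lookup)
open import Data.Fin using (Fin; opposite)
open import Data.Empty using (⊥)
open import Relation.Binary.PropositionalEquality using (_≡_; _≢_)
open import Relation.Nullary using (¬_)

NonSquare : ℕ → Set
NonSquare n = ∀ x → x * x ≢ n

_≡_[mod_] : ℕ → ℕ → ℕ → Set
a ≡ b [mod k ] = k ∣ ∣ a - b ∣

BestMod : ℕ → ℕ → ℕ → Set
BestMod n k m =
  0 < m × (∀ m' → 0 < m' → m' ≡ m [mod k ] → ∣ m * m - n ∣ ≤ ∣ m' * m' - n ∣)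

Triple : Set
Triple = ℕ × ℕ × ℕ

fst₃ : Triple → ℕ
fst₃ (a , _ , _) = a
mid₃ : Triple → ℕ
mid₃ (_ , b , _) = b
lst₃ : Triple → ℕ
lst₃ (_ , _ , c) = c

flip₃ : Triple → Triple
flip₃ (a , b , c) = (c , b , a)

-- One stage of the algorithm with previous m = mp and current k:
-- choose m ≡ -mp (mod k), m best mod k, and k' = |m² - n| / k.
Stage : ℕ → ℕ → ℕ → ℕ → ℕ → Set
Stage n mp k m k' = k ∣ (m + mp) × BestMod n k m × ∣ m * m - n ∣ ≡ k * k'

data Seq : Set where
  fin : List Triple → Seq
  inf : (ℕ → Triple) → Seq

_≈ˢ_ : Seq → Seq → Set
fin l ≈ˢ fin l' = l ≡ l'
fin _ ≈ˢ inf _ = ⊥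
inf _ ≈ˢ fin _ = ⊥
inf f ≈ˢ inf g = ∀ i → f i ≡ g i

data FinRun (n : ℕ) : ℕ → ℕ → List Triple → Set where
  stop : ∀ {mp k m k'} → Stage n mp k m k' → k' ≡ 1 →
         FinRun n mp k ((k , m , k') ∷ [])
  cont : ∀ {mp k m k' rest} → Stage n mp k m k' → k' ≢ 1 →
         FinRun n m k' rest → FinRun n mp k ((k , m , k') ∷ rest)

-- m_{i-1} in an infinite run (m_{-1} = 0)
prevM : (ℕ → Triple) → ℕ → ℕ
prevM s zero = 0
prevM s (suc i) = mid₃ (s i)

InfRun : ℕ → (ℕ → Triple) → Set
InfRun n s =
  fst₃ (s 0) ≡ 1 ×
  (∀ i → Stage n (prevM s i) (fst₃ (s i)) (mid₃ (s i)) (lst₃ (s i))) ×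
  (∀ i → lst₃ (s i) ≡ fst₃ (s (suc i))) ×
  (∀ i → lst₃ (s i) ≢ 1)

Produced : ℕ → Seq → Set
Produced n (fin l) = FinRun n 0 1 l
Produced n (inf s) = InfRun n s

FiniteSymmetric : Seq → Set
FiniteSymmetric s =
  Σ (List Triple) λ l → s ≡ fin l ×
    (∀ (j : Fin (length l)) → lookup l (opposite j) ≡ flip₃ (lookup l j))

module Submission where

-- The heart is the reversal lemma: along a run each
-- choice m_i is best not only mod k_i but also mod k_{i+1}, so every step
-- (k_i, m_i, k_{i+1}) read backwards is the step (k_{i+1}, m_i, k_i).  Being
-- best mod d is expressed as a linear inequality in x, d and the cofactor d' of
-- the gap |x² − n| = d·d' (module Gap); the lemma then reduces to a case split
-- on the multiplier t in m_{i−1} + m_i = t·k_i, each case closed by linear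
-- arithmetic (module Steps).  Hence a finite run reversed is again a run, and
-- uniqueness makes it equal to the original: this is the symmetry.  An infinite
-- run has bounded stages (k_i, m_i), so one repeats; stepping back from the
-- repetition either repeats an earlier stage or exhibits two symmetric best
-- choices, which let a run turn around onto an earlier prefix and end at k = 1,
-- contradicting uniqueness (module Runs).

open import Defs
open import Data.Nat
open import Data.Nat.Properties
open import Data.Nat.Divisibility using (_∣_; divides; ∣⇒≤; ∣-refl; 1∣_; ∣m+n∣m⇒∣n; ∣m∣n⇒∣m+n)
open import Data.Nat.Tactic.RingSolver using (solve; solve-∀)
open import Data.List using (List; []; _∷_; length; lookup; map; reverseAcc)
open import Data.Fin using (Fin; toℕ; opposite; combine; fromℕ<) renaming (zero to fzero; suc to fsuc)
open import Data.Fin.Properties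
  using (toℕ-injective; toℕ<n; opposite-prop; combine-injective; fromℕ<-injective; pigeonhole)
open import Data.Product using (_×_; _,_; proj₁; proj₂)
open import Data.Sum using (_⊎_; inj₁; inj₂)
open import Data.Empty using (⊥; ⊥-elim)
open import Function using (case_of_)
open import Relation.Nullary using (yes; no)
open import Relation.Binary using (tri<; tri≈; tri>)
open import Relation.Binary.PropositionalEquality

positive-factors : ∀ a b → 0 < a * b → 0 < a × 0 < b
positive-factors (suc a) (suc b) _ = z<s , z<s
positive-factors (suc a) zero    ab>0 rewrite *-zeroʳ a = ⊥-elim (<-irrefl refl ab>0)

∣-distance : ∀ {d x y} → d ∣ x → d ∣ y → d ∣ ∣ x - y ∣
∣-distance {d} {x} {y} d∣x d∣y with ≤-total x y
... | inj₁ x≤y = subst (d ∣_) (sym (m≤n⇒∣m-n∣≡n∸m x≤y))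
                   (∣m+n∣m⇒∣n (subst (d ∣_) (sym (m+[n∸m]≡n x≤y)) d∣y) d∣x)
... | inj₂ y≤x = subst (d ∣_) (sym (m≤n⇒∣n-m∣≡n∸m y≤x))
                   (∣m+n∣m⇒∣n (subst (d ∣_) (sym (m+[n∸m]≡n y≤x)) d∣x) d∣y)

-- A linear contradiction: valid inequalities, scaled by constants and added
-- up, give L ≤ R although L exceeds R identically (checked by the ring solver).
impossible : ∀ {L R} slack → L ≤ R → L ≡ suc (R + slack) → ⊥
impossible {L} {R} slack L≤R L≡ =
  <-irrefl refl (≤-trans (s≤s (m≤m+n R slack)) (subst (_≤ R) L≡ L≤R))

infixr 5 _⊕_
_⊕_ : ∀ {a b c d} → a ≤ b → c ≤ d → a + c ≤ b + d
_⊕_ = +-mono-≤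

infixr 6 _·_
_·_ : ∀ c {a b} → a ≤ b → c * a ≤ c * b
c · a≤b = *-monoʳ-≤ c a≤b

-- If c + m = t·k, then c² + k·a = m² + k·b says t·c + a = t·m + b,
-- because c² − m² = (c − m)(c + m) = t·k·(c − m).
cross : ∀ {k c m t a b} → 0 < k → c + m ≡ t * k → c * c + k * a ≡ m * m + k * b →
        t * c + a ≡ t * m + b
cross {k} {c} {m} {t} {a} {b} k>0 c+m≡tk e = *-cancelˡ-≡ _ _ k {{>-nonZero k>0}} (begin
  k * (t * c + a)         ≡⟨ solve (k ∷ c ∷ t ∷ a ∷ []) ⟩
  (t * k) * c + k * a     ≡⟨ cong (λ z → z * c + k * a) c+m≡tk ⟨
  (c + m) * c + k * a     ≡⟨ solve (k ∷ c ∷ m ∷ a ∷ []) ⟩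
  (c * c + k * a) + m * c ≡⟨ cong (_+ m * c) e ⟩
  (m * m + k * b) + m * c ≡⟨ solve (k ∷ c ∷ m ∷ b ∷ []) ⟩
  (c + m) * m + k * b     ≡⟨ cong (λ z → z * m + k * b) c+m≡tk ⟩
  (t * k) * m + k * b     ≡⟨ solve (k ∷ m ∷ t ∷ b ∷ []) ⟩
  k * (t * m + b)         ∎)
  where open ≡-Reasoning

scale-down : ∀ {j t x y a b} → j ≤ t → y ≤ x → t * x + a ≡ t * y + b → j * x + a ≤ j * y + b
scale-down {j} {t} {x} {y} {a} {b} j≤t y≤x e = +-cancelʳ-≤ (d * y) _ _ (begin
  j * x + a + d * y   ≤⟨ +-monoʳ-≤ (j * x + a) (*-monoʳ-≤ d y≤x) ⟩
  j * x + a + d * x   ≡⟨ regroup j d x a ⟨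
  (j + d) * x + a     ≡⟨ cong (λ s → s * x + a) j+d≡t ⟩
  t * x + a           ≡⟨ e ⟩
  t * y + b           ≡⟨ cong (λ s → s * y + b) j+d≡t ⟨
  (j + d) * y + b     ≡⟨ regroup j d y b ⟩
  j * y + b + d * y   ∎)
  where
  open ≤-Reasoning
  d = t ∸ j
  j+d≡t : j + d ≡ t
  j+d≡t = m+[n∸m]≡n j≤t
  regroup : ∀ j d x a → (j + d) * x + a ≡ j * x + a + d * x
  regroup = solve-∀

-- Two consecutive choices c, m of a run satisfy c + m = t·k.  The three
-- regimes t = 1, t = 2, t ≥ 3, with what the relation c² + k·a = m² + k·b
-- (equivalently t·c + a = t·m + b) says in each.
data Regime (k c m a b : ℕ) : Set where
  once  : c + m ≡ k → c + a ≡ m + b → Regime k c m a b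
  twice : c + m ≡ 2 * k → 2 * c + a ≡ 2 * m + b → Regime k c m a b
  often : 3 * k ≤ c + m → (m ≤ c → 3 * c + a ≤ 3 * m + b) → Regime k c m a b

regime : ∀ {k c m a b} t → 0 < k → 0 < c → c + m ≡ t * k → c * c + k * a ≡ m * m + k * b →
         Regime k c m a b
regime 0 _ (s≤s _) () _
regime {k} {c} {m} {a} {b} 1 k>0 _ c+m≡k e =
  once (trans c+m≡k (*-identityˡ k))
       (subst₂ (λ x y → x + a ≡ y + b) (*-identityˡ c) (*-identityˡ m)
               (cross {k} {c} {m} {1} k>0 c+m≡k e))
regime {k} {c} {m} 2 k>0 _ c+m≡2k e = twice c+m≡2k (cross {k} {c} {m} {2} k>0 c+m≡2k e)
regime {k} {c} {m} {a} {b} t@(suc (suc (suc _))) k>0 _ c+m≡tk e =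
  often (subst (3 * k ≤_) (sym c+m≡tk) (*-monoˡ-≤ k 3≤t))
        (λ m≤c → scale-down {3} {t} {c} {m} {a} {b} 3≤t m≤c (cross {k} {c} {m} {t} k>0 c+m≡tk e))
  where
  3≤t : 3 ≤ t
  3≤t = s≤s (s≤s (s≤s z≤n))

module _ {A B : Set} (f : A → B) where

  lookup-reverseAcc-acc : ∀ acc xs (i : Fin (length (reverseAcc acc (map f xs))))
                          (j : Fin (length acc)) → toℕ i ≡ toℕ j + length xs →
                          lookup (reverseAcc acc (map f xs)) i ≡ lookup acc j
  lookup-reverseAcc-acc acc []       i j i≡j+0 =
    cong (lookup acc) (toℕ-injective (trans i≡j+0 (+-identityʳ (toℕ j))))
  lookup-reverseAcc-acc acc (x ∷ xs) i j i≡ =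
    lookup-reverseAcc-acc (f x ∷ acc) xs i (fsuc j) (trans i≡ (+-suc (toℕ j) (length xs)))

  lookup-reverseAcc-map : ∀ acc xs (i : Fin (length (reverseAcc acc (map f xs))))
                          (j : Fin (length xs)) → toℕ i + suc (toℕ j) ≡ length xs →
                          lookup (reverseAcc acc (map f xs)) i ≡ f (lookup xs j)
  lookup-reverseAcc-map acc (x ∷ xs) i fzero i+1≡ =
    lookup-reverseAcc-acc (f x ∷ acc) xs i fzero
      (+-cancelʳ-≡ 1 (toℕ i) (length xs) (trans i+1≡ (+-comm 1 (length xs))))
  lookup-reverseAcc-map acc (x ∷ xs) i (fsuc j) i+j+2≡ =
    lookup-reverseAcc-map (f x ∷ acc) xs i j
      (suc-injective (trans (sym (+-suc (toℕ i) (suc (toℕ j)))) i+j+2≡))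

opposite-sum : ∀ {m} (j : Fin m) → toℕ (opposite j) + suc (toℕ j) ≡ m
opposite-sum {m} j = trans (cong (_+ suc (toℕ j)) (opposite-prop j)) (m∸n+n≡m (toℕ<n j))

palindrome : ∀ l → reverseAcc [] (map flip₃ l) ≡ l →
             ∀ (j : Fin (length l)) → lookup l (opposite j) ≡ flip₃ (lookup l j)
palindrome l mirror≡l j =
  subst Mirrored mirror≡l (lookup-reverseAcc-map flip₃ [] l) (opposite j) j (opposite-sum j)
  where
  Mirrored : List Triple → Set
  Mirrored r = ∀ (i : Fin (length r)) (j : Fin (length l)) →
               toℕ i + suc (toℕ j) ≡ length l → lookup r i ≡ flip₃ (lookup l j)

square-step : ∀ x d → (x + d) * (x + d) ≡ x * x + d * (2 * x + d)
square-step = solve-∀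

double-step : ∀ r d → 2 * r + d + d ≡ 2 * (r + d)
double-step = solve-∀
module Gap (n : ℕ) where

  gap : ℕ → ℕ
  gap x = ∣ x * x - n ∣

  gap-mono : ∀ {x y} → x ≤ y → n ≤ x * x → gap x ≤ gap y
  gap-mono {x} {y} x≤y n≤x² rewrite m≤n⇒∣n-m∣≡n∸m n≤x²
                                  | m≤n⇒∣n-m∣≡n∸m (≤-trans n≤x² (*-mono-≤ x≤y x≤y))
    = ∸-monoˡ-≤ n (*-mono-≤ x≤y x≤y)

  gap-anti : ∀ {x y} → x ≤ y → y * y ≤ n → gap y ≤ gap x
  gap-anti {x} {y} x≤y y²≤n rewrite m≤n⇒∣m-n∣≡n∸m y²≤n
                                  | m≤n⇒∣m-n∣≡n∸m (≤-trans (*-mono-≤ x≤y x≤y) y²≤n)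
    = ∸-monoʳ-≤ n (*-mono-≤ x≤y x≤y)

  gap-mono-< : ∀ {x y} → x < y → n ≤ x * x → gap x < gap y
  gap-mono-< {x} {y} x<y n≤x² rewrite m≤n⇒∣n-m∣≡n∸m n≤x²
                                    | m≤n⇒∣n-m∣≡n∸m (≤-trans n≤x² (<⇒≤ (*-mono-< x<y x<y)))
    = ∸-monoˡ-< (*-mono-< x<y x<y) n≤x²

  gap-anti-< : ∀ {x y} → x < y → y * y ≤ n → gap y < gap x
  gap-anti-< {x} {y} x<y y²≤n rewrite m≤n⇒∣m-n∣≡n∸m y²≤n
                                    | m≤n⇒∣m-n∣≡n∸m (≤-trans (<⇒≤ (*-mono-< x<y x<y)) y²≤n)
    = ∸-monoʳ-< (*-mono-< x<y x<y) y²≤n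

  next-up : ∀ {k m m'} → m' ≡ m [mod k ] → m < m' → m + k ≤ m'
  next-up {k} {m} {m'} k∣m'-m m<m' = begin
    m + k         ≤⟨ +-monoʳ-≤ m (∣⇒≤ {{>-nonZero (m<n⇒0<n∸m m<m')}}
                                      (subst (k ∣_) (m≤n⇒∣n-m∣≡n∸m (<⇒≤ m<m')) k∣m'-m)) ⟩
    m + (m' ∸ m)  ≡⟨ m+[n∸m]≡n (<⇒≤ m<m') ⟩
    m'            ∎
    where open ≤-Reasoning

  next-down : ∀ {k m m'} → m' ≡ m [mod k ] → m' < m → m' + k ≤ m
  next-down {k} {m} {m'} k∣m'-m = next-up (subst (k ∣_) (∣-∣-comm m' m) k∣m'-m)

  -- Since gap is unimodal, a number is best in its class as soon as it beats
  -- its two neighbours m + k and m − k.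
  best-from-neighbours : ∀ {k m} → 0 < m → 0 < k → gap m ≤ gap (m + k) →
                         (k < m → gap m ≤ gap (m ∸ k)) → BestMod n k m
  best-from-neighbours {k} {m} m>0 k>0 up down = m>0 , beats
    where
    beats-lower : ∀ {m'} → 0 < m' → m' + k ≤ m → gap m ≤ gap m'
    beats-lower {m'} m'>0 m'+k≤m = case ≤-total ((m ∸ k) * (m ∸ k)) n of λ where
        (inj₁ ≤n) → ≤-trans (down k<m) (gap-anti m'≤m-k ≤n)
        (inj₂ n≤) → ⊥-elim (<⇒≱ (gap-mono-< (∸-monoʳ-< {m} {k} {0} k>0 (<⇒≤ k<m)) n≤)
                                (down k<m))
      where
      k<m : k < m
      k<m = <-≤-trans (subst (_< m' + k) (+-identityˡ k) (+-monoˡ-< k m'>0)) m'+k≤m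
      m'≤m-k : m' ≤ m ∸ k
      m'≤m-k = subst (_≤ m ∸ k) (m+n∸n≡m m' k) (∸-monoˡ-≤ k m'+k≤m)

    beats : ∀ m' → 0 < m' → m' ≡ m [mod k ] → gap m ≤ gap m'
    beats m' m'>0 m'≡m with <-cmp m m'
    ... | tri≈ _ refl _ = ≤-refl
    ... | tri< m<m' _ _ with ≤-total n ((m + k) * (m + k))
    ...   | inj₁ n≤ = ≤-trans up (gap-mono (next-up m'≡m m<m') n≤)
    ...   | inj₂ ≤n = ⊥-elim (<⇒≱ (gap-anti-< (m<m+n m k>0) ≤n) up)
    beats m' m'>0 m'≡m | tri> _ _ m'<m = beats-lower m'>0 (next-down m'≡m m'<m)

  gap-below-by : ∀ {x D} → x * x + D ≡ n → gap x ≡ D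
  gap-below-by {x} {D} e rewrite sym e = ∣m-m+n∣≡n (x * x) D

  gap-above-by : ∀ {x D} → n + D ≡ x * x → gap x ≡ D
  gap-above-by {x} {D} e rewrite sym e = trans (∣-∣-comm (n + D) n) (∣m-m+n∣≡n n D)

  side : ∀ x {D} → gap x ≡ D → (x * x + D ≡ n) ⊎ (n + D ≡ x * x)
  side x e with ≤-total (x * x) n
  ... | inj₁ x²≤n = inj₁ (trans (cong (x * x +_) (trans (sym e) (m≤n⇒∣m-n∣≡n∸m x²≤n)))
                                (m+[n∸m]≡n x²≤n))
  ... | inj₂ n≤x² = inj₂ (trans (cong (n +_) (trans (sym e) (m≤n⇒∣n-m∣≡n∸m n≤x²)))
                                (m+[n∸m]≡n n≤x²))

  shift-same-class : ∀ x d → x ≡ x + d [mod d ]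
  shift-same-class x d = subst (d ∣_) (sym (∣m-m+n∣≡n x d)) ∣-refl

  gap-up-below : ∀ {x d d'} → x * x + d * d' ≡ n → gap (x + d) ≡ d * ∣ 2 * x + d - d' ∣
  gap-up-below {x} {d} {d'} e = begin
    ∣ (x + d) * (x + d) - n ∣                  ≡⟨ cong₂ ∣_-_∣ (square-step x d) (sym e) ⟩
    ∣ x * x + d * (2 * x + d) - x * x + d * d' ∣ ≡⟨ ∣m+n-m+o∣≡∣n-o∣ (x * x) _ _ ⟩
    ∣ d * (2 * x + d) - d * d' ∣               ≡⟨ *-distribˡ-∣-∣ d (2 * x + d) d' ⟨
    d * ∣ 2 * x + d - d' ∣                     ∎
    where open ≡-Reasoning

  gap-down-above : ∀ {r d d'} → n + d * d' ≡ (r + d) * (r + d) → gap r ≡ d * ∣ 2 * r + d - d' ∣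
  gap-down-above {r} {d} {d'} e = begin
    ∣ r * r - n ∣                     ≡⟨ ∣m+n-m+o∣≡∣n-o∣ (d * d') (r * r) n ⟨
    ∣ d * d' + r * r - d * d' + n ∣     ≡⟨ cong₂ ∣_-_∣ (+-comm (d * d') (r * r)) (+-comm (d * d') n) ⟩
    ∣ r * r + d * d' - n + d * d' ∣     ≡⟨ cong (∣ r * r + d * d' -_∣) (trans e (square-step r d)) ⟩
    ∣ r * r + d * d' - r * r + d * (2 * r + d) ∣ ≡⟨ ∣m+n-m+o∣≡∣n-o∣ (r * r) _ _ ⟩
    ∣ d * d' - d * (2 * r + d) ∣       ≡⟨ *-distribˡ-∣-∣ d d' (2 * r + d) ⟨
    d * ∣ d' - 2 * r + d ∣             ≡⟨ cong (d *_) (∣-∣-comm d' (2 * r + d)) ⟩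
    d * ∣ 2 * r + d - d' ∣             ∎
    where open ≡-Reasoning

  d≤∣a-d∣⇒2d≤a : ∀ {a d} → 0 < a → d ≤ ∣ a - d ∣ → 2 * d ≤ a
  d≤∣a-d∣⇒2d≤a {a} {d} a>0 h with ≤-total d a
  ... | inj₁ d≤a rewrite m≤n⇒∣n-m∣≡n∸m d≤a | +-identityʳ d =
        subst (d + d ≤_) (m+[n∸m]≡n d≤a) (+-monoʳ-≤ d h)
  ... | inj₂ a≤d rewrite m≤n⇒∣m-n∣≡n∸m a≤d = ⊥-elim (<⇒≱ (∸-monoʳ-< {d} {a} {0} a>0 a≤d) h)

  2d≤a⇒d≤∣a-d∣ : ∀ {a d} → 2 * d ≤ a → d ≤ ∣ a - d ∣
  2d≤a⇒d≤∣a-d∣ {a} {d} h rewrite +-identityʳ d | m≤n⇒∣n-m∣≡n∸m (m+n≤o⇒m≤o d h) =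
    subst (_≤ a ∸ d) (m+n∸n≡m d d) (∸-monoˡ-≤ d h)

  below-best⇒ : ∀ {x d d'} → 0 < d → x * x + d * d' ≡ n → BestMod n d x → 2 * d' ≤ 2 * x + d
  below-best⇒ {x} {d} {d'} d>0 e (x>0 , best) =
    d≤∣a-d∣⇒2d≤a (≤-trans d>0 (m≤n+m d (2 * x)))
      (*-cancelˡ-≤ d {{>-nonZero d>0}}
        (subst₂ _≤_ (gap-below-by {x} e) (gap-up-below {x} {d} {d'} e)
          (best (x + d) (≤-trans x>0 (m≤m+n x d))
                (subst (d ∣_) (∣-∣-comm x (x + d)) (shift-same-class x d)))))

  below-best⇐ : ∀ {x d d'} → 0 < x → 0 < d → x * x + d * d' ≡ n → 2 * d' ≤ 2 * x + d →
                BestMod n d x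
  below-best⇐ {x} {d} {d'} x>0 d>0 e h = best-from-neighbours x>0 d>0 up down
    where
    up : gap x ≤ gap (x + d)
    up = subst₂ _≤_ (sym (gap-below-by {x} e)) (sym (gap-up-below {x} {d} {d'} e))
                    (*-monoʳ-≤ d (2d≤a⇒d≤∣a-d∣ h))
    down : d < x → gap x ≤ gap (x ∸ d)
    down _ = gap-anti (m∸n≤m x d) (subst (x * x ≤_) e (m≤m+n (x * x) (d * d')))

  above-best⇒ : ∀ {x d d'} → 0 < d → n + d * d' ≡ x * x → BestMod n d x → d < x →
                2 * d' + d ≤ 2 * x
  above-best⇒ {x} {d} {d'} d>0 e (_ , best) d<x =
    subst (2 * d' + d ≤_) (trans (double-step r d) (cong (2 *_) r+d≡x)) (+-monoˡ-≤ d 2d'≤2r+d)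
    where
    r = x ∸ d
    r+d≡x : r + d ≡ x
    r+d≡x = m∸n+n≡m (<⇒≤ d<x)
    2d'≤2r+d : 2 * d' ≤ 2 * r + d
    2d'≤2r+d = d≤∣a-d∣⇒2d≤a (≤-trans d>0 (m≤n+m d (2 * r)))
      (*-cancelˡ-≤ d {{>-nonZero d>0}}
        (subst₂ _≤_ (gap-above-by {x} e)
                    (gap-down-above {r} {d} {d'} (trans e (cong (λ z → z * z) (sym r+d≡x))))
          (best r (m<n⇒0<n∸m d<x) (subst (λ z → d ∣ ∣ r - z ∣) r+d≡x (shift-same-class r d)))))

  above-best⇐ : ∀ {x d d'} → 0 < x → 0 < d → n + d * d' ≡ x * x →
                (d < x → 2 * d' + d ≤ 2 * x) → BestMod n d x
  above-best⇐ {x} {d} {d'} x>0 d>0 e h = best-from-neighbours x>0 d>0 up down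
    where
    up : gap x ≤ gap (x + d)
    up = gap-mono (m≤m+n x d) (subst (n ≤_) e (m≤m+n n (d * d')))
    down : d < x → gap x ≤ gap (x ∸ d)
    down d<x = subst₂ _≤_ (sym (gap-above-by {x} e)) (sym (gap-down-above {r} {d} {d'} e'))
                 (*-monoʳ-≤ d (2d≤a⇒d≤∣a-d∣ 2d'≤2r+d))
      where
      r = x ∸ d
      r+d≡x : r + d ≡ x
      r+d≡x = m∸n+n≡m (<⇒≤ d<x)
      e' : n + d * d' ≡ (r + d) * (r + d)
      e' = trans e (cong (λ z → z * z) (sym r+d≡x))
      2d'≤2r+d : 2 * d' ≤ 2 * r + d
      2d'≤2r+d = +-cancelʳ-≤ d _ _
        (subst (2 * d' + d ≤_) (trans (cong (2 *_) (sym r+d≡x)) (sym (double-step r d))) (h d<x))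

module Steps (n : ℕ) (n>0 : 0 < n) (nonsquare : NonSquare n) where
  open Gap n

  gap-pos : ∀ x → 0 < gap x
  gap-pos x with gap x in eq
  ... | zero  = ⊥-elim (nonsquare x (∣m-n∣≡0⇒m≡n eq))
  ... | suc _ = z<s

  gap-factors-pos : ∀ {x a b} → gap x ≡ a * b → 0 < a × 0 < b
  gap-factors-pos {x} {a} {b} e = positive-factors a b (subst (0 <_) e (gap-pos x))

  -- x is best modulo both factors of its gap d·d', in linear form.
  data TwoSided (d d' x : ℕ) : Set where
    below : x * x + d * d' ≡ n → 2 * d' ≤ 2 * x + d → 2 * d ≤ 2 * x + d' → TwoSided d d' x
    above : n + d * d' ≡ x * x → 2 * d' + d ≤ 2 * x → 2 * d + d' ≤ 2 * x → TwoSided d d' x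

  -- Above √n such an x exceeds both factors (x ≤ d, d' is impossible since
  -- x² ≤ d·d' < n + d·d'), so both conditions of above-best⇒ apply.
  two-sided : ∀ {d d' x} → gap x ≡ d * d' → BestMod n d x → BestMod n d' x → TwoSided d d' x
  two-sided {d} {d'} {x} g bd bd' = by-side (side x g)
    where
    d>0 = proj₁ (gap-factors-pos {x} {d} {d'} g)
    d'>0 = proj₂ (gap-factors-pos {x} {d} {d'} g)
    by-side : (x * x + d * d' ≡ n) ⊎ (n + d * d' ≡ x * x) → TwoSided d d' x
    by-side (inj₁ e) = below e (below-best⇒ d>0 e bd) (below-best⇒ d'>0 e' bd')
      where
      e' : x * x + d' * d ≡ n
      e' = trans (cong (x * x +_) (*-comm d' d)) e
    by-side (inj₂ e) = above e (above-best⇒ d>0 e bd d<x) (above-best⇒ d'>0 e' bd' d'<x)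
      where
      e' : n + d' * d ≡ x * x
      e' = trans (cong (n +_) (*-comm d' d)) e
      not-both : x ≤ d → x ≤ d' → ⊥
      not-both x≤d x≤d' = <-irrefl refl (begin-strict
        x * x      ≤⟨ *-mono-≤ x≤d x≤d' ⟩
        d * d'     <⟨ m<n+m (d * d') n>0 ⟩
        n + d * d' ≡⟨ e ⟩
        x * x      ∎)
        where open ≤-Reasoning
      d<x : d < x
      d<x = ≰⇒> λ (x≤d : x ≤ d) → impossible 0
        (above-best⇒ d'>0 e' bd' (≰⇒> (not-both x≤d)) ⊕ 2 · x≤d ⊕ d'>0) (solve (d ∷ d' ∷ x ∷ []))
      d'<x : d' < x
      d'<x = ≰⇒> λ (x≤d' : x ≤ d') → impossible 0
        (above-best⇒ d>0 e bd (≰⇒> (λ x≤d → not-both x≤d x≤d')) ⊕ 2 · x≤d' ⊕ d>0)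
        (solve (d ∷ d' ∷ x ∷ []))

  -- Such an x is at most n, and so is d: below √n this is clear; above √n,
  -- x exceeds d and d', and then x·(x − d) = n + d·(d' − x) ≤ n.
  two-sided-bounded : ∀ {d d' x} → 0 < d' → 0 < x → TwoSided d d' x → d ≤ n × x ≤ n
  two-sided-bounded {d} {d'} {x} d'>0 x>0 (below e _ _) =
    ≤-trans (m≤m*n d d' {{>-nonZero d'>0}}) (≤-trans (m≤n+m (d * d') (x * x)) (≤-reflexive e)) ,
    ≤-trans (m≤m*n x x {{>-nonZero x>0}}) (≤-trans (m≤m+n (x * x) (d * d')) (≤-reflexive e))
  two-sided-bounded {d} {d'} {x} d'>0 x>0 (above e 2d'+d≤2x 2d+d'≤2x) =
    ≤-trans (<⇒≤ d<x) x≤n , x≤n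
    where
    d<x : d < x
    d<x = ≰⇒> λ (x≤d : x ≤ d) →
      impossible 0 (2d+d'≤2x ⊕ 2 · x≤d ⊕ d'>0) (solve (d ∷ d' ∷ x ∷ []))
    d'≤x : d' ≤ x
    d'≤x = *-cancelˡ-≤ 2 (≤-trans (m≤m+n (2 * d') d) 2d'+d≤2x)
    x≤n : x ≤ n
    x≤n = ≤-trans (m≤n*m x (x ∸ d) {{>-nonZero (m<n⇒0<n∸m d<x)}}) (+-cancelˡ-≤ (d * x) _ _ (begin
      d * x + (x ∸ d) * x  ≡⟨ *-distribʳ-+ x d (x ∸ d) ⟨
      (d + (x ∸ d)) * x    ≡⟨ cong (_* x) (m+[n∸m]≡n (<⇒≤ d<x)) ⟩
      x * x                ≡⟨ e ⟨
      n + d * d'           ≤⟨ +-monoʳ-≤ n (*-monoʳ-≤ d d'≤x) ⟩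
      n + d * x            ≡⟨ +-comm n (d * x) ⟩
      d * x + n            ∎))
      where open ≤-Reasoning

  -- Two different best members a < b of one class mod k with the same gap K·k
  -- must straddle √n exactly one step apart, so that a + b = 2K.
  tie< : ∀ {k a b K} → a < b → BestMod n k a → b ≡ a [mod k ] →
         gap a ≡ K * k → gap b ≡ K * k → a + b ≡ 2 * K
  tie< {k} {a} {b} {K} a<b ba b≡a ga gb with side a ga | side b gb
  ... | inj₁ ea | inj₁ eb =
    ⊥-elim (<-irrefl (+-cancelʳ-≡ (K * k) _ _ (trans ea (sym eb))) (*-mono-< a<b a<b))
  ... | inj₂ ea | inj₂ eb = ⊥-elim (<-irrefl (trans (sym ea) eb) (*-mono-< a<b a<b))
  ... | inj₂ ea | inj₁ eb = ⊥-elim (<⇒≱ (*-mono-< a<b a<b) (begin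
    b * b          ≤⟨ m≤m+n (b * b) (K * k) ⟩
    b * b + K * k  ≡⟨ eb ⟩
    n              ≤⟨ m≤m+n n (K * k) ⟩
    n + K * k      ≡⟨ ea ⟩
    a * a          ∎))
    where open ≤-Reasoning
  ... | inj₁ ea | inj₂ eb with a + k ≟ b
  ...   | yes a+k≡b = *-cancelˡ-≡ (a + b) (2 * K) k {{>-nonZero k>0}}
                        (+-cancelˡ-≡ (a * a) _ _ (begin
    a * a + k * (a + b)      ≡⟨ cong (λ z → a * a + k * (a + z)) a+k≡b ⟨
    a * a + k * (a + (a + k)) ≡⟨ square-up a k ⟨
    (a + k) * (a + k)        ≡⟨ cong (λ z → z * z) a+k≡b ⟩
    b * b                    ≡⟨ eb ⟨
    n + K * k                ≡⟨ cong (_+ K * k) ea ⟨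
    a * a + K * k + K * k    ≡⟨ double-tail (a * a) K k ⟩
    a * a + k * (2 * K)      ∎))
    where
    open ≡-Reasoning
    k>0 = proj₂ (gap-factors-pos {a} {K} {k} ga)
    square-up : ∀ a k → (a + k) * (a + k) ≡ a * a + k * (a + (a + k))
    square-up = solve-∀
    double-tail : ∀ x K k → x + K * k + K * k ≡ x + k * (2 * K)
    double-tail = solve-∀
  ...   | no a+k≢b = ⊥-elim (<⇒≱ closer (proj₂ ba z z>0 z≡a))
    where
    -- the next member z = a + k of the class lies strictly between a and b
    z = a + k
    k>0 = proj₂ (gap-factors-pos {a} {K} {k} ga)
    z>0 : 0 < z
    z>0 = ≤-trans (proj₁ ba) (m≤m+n a k)
    z≡a : z ≡ a [mod k ]
    z≡a = subst (k ∣_) (∣-∣-comm a z) (shift-same-class a k)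
    closer : gap z < gap a
    closer with ≤-total (z * z) n
    ... | inj₁ z²≤n = gap-anti-< (m<m+n a k>0) z²≤n
    ... | inj₂ n≤z² = subst (gap z <_) (trans gb (sym ga))
                        (gap-mono-< (≤∧≢⇒< (next-up b≡a a<b) a+k≢b) n≤z²)

  tie : ∀ {k a b K} → a ≢ b → BestMod n k a → BestMod n k b → b ≡ a [mod k ] →
        gap a ≡ K * k → gap b ≡ K * k → a + b ≡ 2 * K
  tie {k} {a} {b} {K} a≢b ba bb b≡a ga gb with <-cmp a b
  ... | tri< a<b _ _ = tie< {K = K} a<b ba b≡a ga gb
  ... | tri≈ _ a≡b _ = ⊥-elim (a≢b a≡b)
  ... | tri> _ _ b<a = trans (+-comm a b) (tie< {K = K} b<a bb (subst (k ∣_) (∣-∣-comm b a) b≡a) gb ga)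

  eliminate-n : ∀ {x y p q} → x + p ≡ n → n + q ≡ y → y ≡ x + (p + q)
  eliminate-n {x} {y} {p} {q} ex ey = trans (sym ey) (trans (cong (_+ q) (sym ex)) (+-assoc x p q))

  -- If c + m = k, then c cannot lie above √n: there c is best mod kp only if
  -- 2k + kp ≤ 2c, while k > c.
  once-above-absurd : ∀ {k kp m c} → 0 < m → c + m ≡ k → 2 * k + kp ≤ 2 * c → ⊥
  once-above-absurd {k} {kp} {m} {c} m>0 c+m≡k by-kp =
    impossible (kp + m) (by-kp ⊕ 2 · ≤-reflexive c+m≡k ⊕ m>0) (solve (k ∷ kp ∷ m ∷ c ∷ []))

  -- Let (kp, c, k) be a step with c best mod k
  -- and mod kp, and m ≡ −c (mod k) best mod k with m² + k·k2 = n; then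
  -- 2k ≤ 2m + k2, i.e. m is best mod k2.  Suppose 2m + k2 < 2k instead:
  --   t = 1: c best mod kp forces k ≤ k2 (c below), or is impossible (c above);
  --          with 2k2 ≤ 2m + k this contradicts 2m + k2 < 2k;
  --   t = 2: c below would make kp negative; c above, best mod kp, gives 2k ≤ 2m + k2;
  --   t ≥ 3: c ≤ m gives 3k ≤ 2m < 2k; c ≥ m contradicts the scaled relation.
  below-step : ∀ {k kp k2 m c} t → 0 < k → 0 < m → 0 < c → m * m + k * k2 ≡ n →
               2 * k2 ≤ 2 * m + k → TwoSided k kp c → c + m ≡ t * k → 2 * k ≤ 2 * m + k2
  below-step {k} {kp} {k2} {m} {c} t k>0 m>0 c>0 eM m-by-k c-two-sided c+m≡tk
    with 2 * k ≤? 2 * m + k2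
  ... | yes ok   = ok
  ... | no fails = ⊥-elim (refute c-two-sided (≰⇒> fails))
    where
    refute : TwoSided k kp c → 2 * m + k2 < 2 * k → ⊥
    refute (below eC _ by-kp) ¬goal
      with regime {m = m} {a = kp} {b = k2} t k>0 c>0 c+m≡tk (trans eC (sym eM))
    ... | once c+m≡k rel =
      impossible 0 (m-by-k ⊕ 3 · (by-kp ⊕ ≤-reflexive rel ⊕ ≤-reflexive c+m≡k) ⊕ ¬goal)
        (solve (k ∷ kp ∷ k2 ∷ m ∷ c ∷ []))
    ... | twice c+m≡2k rel =
      impossible (k2 + kp + 1) (2 · ¬goal ⊕ 2 · ≤-reflexive (sym c+m≡2k) ⊕ ≤-reflexive rel)
        (solve (k ∷ kp ∷ k2 ∷ m ∷ c ∷ []))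
    ... | often 3k≤c+m scaled with ≤-total c m
    ...   | inj₁ c≤m = impossible (k + k2) (3k≤c+m ⊕ c≤m ⊕ ¬goal) (solve (k ∷ k2 ∷ m ∷ c ∷ []))
    ...   | inj₂ m≤c = impossible (3 * k + kp + 2 * k2 + 2) (3 · 3k≤c+m ⊕ scaled m≤c ⊕ 3 · ¬goal)
                         (solve (k ∷ kp ∷ k2 ∷ m ∷ c ∷ []))
    refute (above eC by-k by-kp) ¬goal
      with regime {m = m} {a = 0} {b = k2 + kp} t k>0 c>0 c+m≡tk c-from-m
      where
      c-from-m : c * c + k * 0 ≡ m * m + k * (k2 + kp)
      c-from-m = begin
        c * c + k * 0             ≡⟨ solve (c ∷ k ∷ []) ⟩
        c * c                     ≡⟨ eliminate-n {m * m} {c * c} {k * k2} {k * kp} eM eC ⟩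
        m * m + (k * k2 + k * kp) ≡⟨ cong (m * m +_) (*-distribˡ-+ k k2 kp) ⟨
        m * m + k * (k2 + kp)     ∎
        where open ≡-Reasoning
    ... | once c+m≡k _ = once-above-absurd m>0 c+m≡k by-kp
    ... | twice _ rel  =
      impossible 0 (by-kp ⊕ ≤-reflexive rel ⊕ ¬goal) (solve (k ∷ kp ∷ k2 ∷ m ∷ c ∷ []))
    ... | often 3k≤c+m scaled with ≤-total c m
    ...   | inj₁ c≤m = impossible (k + k2) (3k≤c+m ⊕ c≤m ⊕ ¬goal) (solve (k ∷ k2 ∷ m ∷ c ∷ []))
    ...   | inj₂ m≤c =
      impossible (3 * k + 3 * k2 + 4) (2 · scaled m≤c ⊕ by-k ⊕ 4 · 3k≤c+m ⊕ 5 · ¬goal)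
        (solve (k ∷ kp ∷ k2 ∷ m ∷ c ∷ []))

  -- The reversal lemma, m above √n (n + k·k2 = m², m best mod k): if k2 < m
  -- then 2k + k2 ≤ 2m, i.e. m is best mod k2.  Suppose 2m < 2k + k2 instead:
  --   t = 1: c best mod kp contradicts k = c + m > c;
  --   t = 2: c best mod kp gives m ≤ c + kp (c below) or c + k2 ≤ m (c above),
  --          both incompatible with the relation and 2m < 2k + k2;
  --   t ≥ 3: c ≤ m is excluded by crowded; c ≥ m contradicts the scaled relation
  --          (directly if c is below √n, with c best mod k if above).
  above-step : ∀ {k kp k2 m c} t → 0 < k → 0 < m → 0 < k2 → 0 < c → n + k * k2 ≡ m * m →
               (k < m → 2 * k2 + k ≤ 2 * m) → TwoSided k kp c → c + m ≡ t * k →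
               k2 < m → 2 * k + k2 ≤ 2 * m
  above-step {k} {kp} {k2} {m} {c} t k>0 m>0 k2>0 c>0 eM m-by-k c-two-sided c+m≡tk k2<m
    with 2 * k + k2 ≤? 2 * m
  ... | yes ok   = ok
  ... | no fails = ⊥-elim (refute c-two-sided (≰⇒> fails))
    where
    -- t ≥ 3 and c ≤ m give 3k ≤ 2m, so k < m and m best mod k yields
    -- 2k2 + k ≤ 2m, incompatible with 2m < 2k + k2.
    crowded : 2 * m < 2 * k + k2 → 3 * k ≤ c + m → c ≤ m → ⊥
    crowded ¬goal 3k≤c+m c≤m =
      impossible 1 (3k≤c+m ⊕ c≤m ⊕ 2 · ¬goal ⊕ m-by-k k<m) (solve (k ∷ k2 ∷ m ∷ c ∷ []))
      where
      k<m : k < m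
      k<m = ≰⇒> λ (m≤k : m ≤ k) →
        impossible 0 (3k≤c+m ⊕ c≤m ⊕ 2 · m≤k ⊕ k>0) (solve (k ∷ m ∷ c ∷ []))

    refute : TwoSided k kp c → 2 * m < 2 * k + k2 → ⊥
    refute (below eC _ by-kp) ¬goal
      with regime {m = m} {a = kp + k2} {b = 0} t k>0 c>0 c+m≡tk c-from-m
      where
      c-from-m : c * c + k * (kp + k2) ≡ m * m + k * 0
      c-from-m = begin
        c * c + k * (kp + k2)     ≡⟨ cong (c * c +_) (*-distribˡ-+ k kp k2) ⟩
        c * c + (k * kp + k * k2) ≡⟨ eliminate-n {c * c} {m * m} {k * kp} {k * k2} eC eM ⟨
        m * m                     ≡⟨ solve (m ∷ k ∷ []) ⟩
        m * m + k * 0             ∎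
        where open ≡-Reasoning
    ... | once c+m≡k rel =
      impossible (c + k2) (by-kp ⊕ 2 · ≤-reflexive c+m≡k ⊕ ≤-reflexive rel ⊕ m>0)
        (solve (k ∷ kp ∷ k2 ∷ m ∷ c ∷ []))
    ... | twice c+m≡2k rel =
      impossible 0 (by-kp ⊕ ≤-reflexive c+m≡2k ⊕ ¬goal ⊕ ≤-reflexive (sym c+m≡2k)
                          ⊕ ≤-reflexive rel)
        (solve (k ∷ kp ∷ k2 ∷ m ∷ c ∷ []))
    ... | often 3k≤c+m scaled with ≤-total c m
    ...   | inj₁ c≤m = crowded ¬goal 3k≤c+m c≤m
    ...   | inj₂ m≤c = impossible kp (scaled m≤c ⊕ 3 · m≤c ⊕ k2>0) (solve (kp ∷ k2 ∷ m ∷ c ∷ []))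
    refute (above eC by-k by-kp) ¬goal
      with regime {m = m} {a = k2} {b = kp} t k>0 c>0 c+m≡tk c-from-m
      where
      c-from-m : c * c + k * k2 ≡ m * m + k * kp
      c-from-m = begin
        c * c + k * k2        ≡⟨ cong (_+ k * k2) eC ⟨
        n + k * kp + k * k2   ≡⟨ +-assoc n (k * kp) (k * k2) ⟩
        n + (k * kp + k * k2) ≡⟨ cong (n +_) (+-comm (k * kp) (k * k2)) ⟩
        n + (k * k2 + k * kp) ≡⟨ +-assoc n (k * k2) (k * kp) ⟨
        n + k * k2 + k * kp   ≡⟨ cong (_+ k * kp) eM ⟩
        m * m + k * kp        ∎
        where open ≡-Reasoning
    ... | once c+m≡k _ = once-above-absurd m>0 c+m≡k by-kp
    ... | twice c+m≡2k rel =
      impossible 0 (by-kp ⊕ ≤-reflexive c+m≡2k ⊕ ≤-reflexive rel ⊕ ¬goal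
                          ⊕ ≤-reflexive (sym c+m≡2k))
        (solve (k ∷ kp ∷ k2 ∷ m ∷ c ∷ []))
    ... | often 3k≤c+m scaled with ≤-total c m
    ...   | inj₁ c≤m = crowded ¬goal 3k≤c+m c≤m
    ...   | inj₂ m≤c =
      impossible 7 (8 · scaled m≤c ⊕ 4 · by-k ⊕ 12 · m≤c ⊕ 4 · 3k≤c+m ⊕ 8 · ¬goal)
        (solve (k ∷ kp ∷ k2 ∷ m ∷ c ∷ []))

  reversal : ∀ {kp c k m k2} → BestMod n kp c → BestMod n k c → gap c ≡ kp * k →
             k ∣ m + c → BestMod n k m → gap m ≡ k * k2 → BestMod n k2 m
  reversal {kp} {c} {k} {m} {k2} bkp bk gc (divides t m+c≡tk) bm gm = by-side (side m gm)
    where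
    k>0 = proj₁ (gap-factors-pos {m} {k} {k2} gm)
    k2>0 = proj₂ (gap-factors-pos {m} {k} {k2} gm)
    c-two-sided : TwoSided k kp c
    c-two-sided = two-sided (trans gc (*-comm kp k)) bk bkp
    c+m≡tk : c + m ≡ t * k
    c+m≡tk = trans (+-comm c m) m+c≡tk
    by-side : (m * m + k * k2 ≡ n) ⊎ (n + k * k2 ≡ m * m) → BestMod n k2 m
    by-side (inj₁ eM) =
      below-best⇐ (proj₁ bm) k2>0 (trans (cong (m * m +_) (*-comm k2 k)) eM)
        (below-step t k>0 (proj₁ bm) (proj₁ bk) eM (below-best⇒ k>0 eM bm) c-two-sided c+m≡tk)
    by-side (inj₂ eM) =
      above-best⇐ (proj₁ bm) k2>0 (trans (cong (n +_) (*-comm k2 k)) eM)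
        (above-step t k>0 (proj₁ bm) k2>0 (proj₁ bk) eM (above-best⇒ k>0 eM bm) c-two-sided c+m≡tk)

module Runs (n : ℕ) (n>0 : 0 < n) (nonsquare : NonSquare n) where
  open Gap n
  open Steps n n>0 nonsquare

  -- Being best mod 1 means being best among all positive integers.
  best-mod-1 : ∀ {d x} → BestMod n 1 x → BestMod n d x
  best-mod-1 (x>0 , best) = x>0 , λ m' m'>0 _ → best m' m'>0 (1∣ _)

  -- The state (previous choice mp, current k) of a run, together with the
  -- steps taken so far, reversed and flipped (acc).  Either the run has just
  -- started (k = 1), or mp is best modulo both multipliers of its step and
  -- acc is a run back to k = 1 from any previous choice compatible with mp.
  data ReversedPrefix : ℕ → ℕ → List Triple → Set where
    start : ∀ {mp} → ReversedPrefix mp 1 []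
    later : ∀ {kp c k acc} → BestMod n kp c → BestMod n k c → gap c ≡ kp * k → k ≢ 1 →
            (∀ x → k ∣ c + x → FinRun n x k acc) → ReversedPrefix c k acc

  reverse-best : ∀ {mp k acc m k'} → ReversedPrefix mp k acc → Stage n mp k m k' → BestMod n k' m
  reverse-best start (_ , bm , _) = best-mod-1 bm
  reverse-best (later bkp bk gc _ _) (k∣m+mp , bm , gm) = reversal bkp bk gc k∣m+mp bm gm

  reversed-stage : ∀ {mp k acc m k' x} → ReversedPrefix mp k acc → Stage n mp k m k' →
                   k' ∣ m + x → Stage n x k' m k
  reversed-stage {k = k} {k' = k'} R st@(_ , _ , gm) k'∣m+x =
    k'∣m+x , reverse-best R st , trans gm (*-comm k k')

  retrace : ∀ {mp k acc m k'} → ReversedPrefix mp k acc → Stage n mp k m k' →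
            ∀ x → k' ∣ m + x → FinRun n x k' ((k' , m , k) ∷ acc)
  retrace R@start st x k'∣m+x = stop (reversed-stage R st k'∣m+x) refl
  retrace {mp} {k} {m = m} R@(later _ _ _ k≢1 back) st@(k∣m+mp , _ , _) x k'∣m+x =
    cont (reversed-stage R st k'∣m+x) k≢1 (back m (subst (k ∣_) (+-comm m mp) k∣m+mp))

  advance : ∀ {mp k acc m k'} → ReversedPrefix mp k acc → Stage n mp k m k' → k' ≢ 1 →
            ReversedPrefix m k' ((k' , m , k) ∷ acc)
  advance R st@(_ , bm , gm) k'≢1 = later bm (reverse-best R st) gm k'≢1 (retrace R st)

  runs-back : ∀ {mp k acc} → ReversedPrefix mp k acc → k ≢ 1 →
              ∀ x → k ∣ mp + x → FinRun n x k acc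
  runs-back start 1≢1 = ⊥-elim (1≢1 refl)
  runs-back (later _ _ _ _ back) _ = back

  reverse-run : ∀ {mp k l acc} → FinRun n mp k l → ReversedPrefix mp k acc →
                FinRun n 0 1 (reverseAcc acc (map flip₃ l))
  reverse-run (stop st refl) R = retrace R st 0 (1∣ _)
  reverse-run (cont st k'≢1 run) R = reverse-run run (advance R st k'≢1)

  module Infinite (s : ℕ → Triple) (run : InfRun n s)
                  (unique : ∀ t → Produced n t → t ≈ˢ inf s) where

    starts-at-1 : fst₃ (s 0) ≡ 1
    starts-at-1 = proj₁ run

    stage : ∀ i → Stage n (prevM s i) (fst₃ (s i)) (mid₃ (s i)) (lst₃ (s i))
    stage = proj₁ (proj₂ run)

    chained : ∀ i → lst₃ (s i) ≡ fst₃ (s (suc i))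
    chained = proj₁ (proj₂ (proj₂ run))

    continues : ∀ i → lst₃ (s i) ≢ 1
    continues = proj₂ (proj₂ (proj₂ run))

    never-1 : ∀ i → fst₃ (s (suc i)) ≢ 1
    never-1 i k≡1 = continues i (trans (chained i) k≡1)

    backward : ℕ → List Triple
    backward zero    = []
    backward (suc i) = flip₃ (s i) ∷ backward i

    reversed-prefix : ∀ i → ReversedPrefix (prevM s i) (fst₃ (s i)) (backward i)
    reversed-prefix zero    = subst (λ k → ReversedPrefix 0 k []) (sym starts-at-1) start
    reversed-prefix (suc i) =
      subst (λ k → ReversedPrefix (mid₃ (s i)) k (backward (suc i))) (chained i)
            (advance (reversed-prefix i) (stage i) (continues i))

    best-after : ∀ i → BestMod n (lst₃ (s i)) (mid₃ (s i))
    best-after i = reverse-best (reversed-prefix i) (stage i)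

    forward : ℕ → List Triple → List Triple
    forward zero    r = r
    forward (suc i) r = forward i (s i ∷ r)

    prefix-run : ∀ i {r} → FinRun n (prevM s i) (fst₃ (s i)) r → FinRun n 0 1 (forward i r)
    prefix-run zero    {r} run' = subst (λ k → FinRun n 0 k r) starts-at-1 run'
    prefix-run (suc i) {r} run' =
      prefix-run i (cont (stage i) (continues i)
                         (subst (λ k → FinRun n (mid₃ (s i)) k r) (sym (chained i)) run'))

    -- If k_{i+1} = k_{j+1} divides m_i + m_j, then after step j we may follow the
    -- first i+1 steps backwards: a finite run, contradicting uniqueness.
    no-shortcut : ∀ i j → fst₃ (s (suc i)) ≡ fst₃ (s (suc j)) →
                  fst₃ (s (suc i)) ∣ mid₃ (s i) + mid₃ (s j) → ⊥
    no-shortcut i j k≡ k∣ = unique (fin _) (prefix-run (suc j) turn-around)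
      where
      turn-around : FinRun n (mid₃ (s j)) (fst₃ (s (suc j))) (backward (suc i))
      turn-around = subst (λ k → FinRun n (mid₃ (s j)) k (backward (suc i))) k≡
                          (runs-back (reversed-prefix (suc i)) (never-1 i) (mid₃ (s j)) k∣)

    returns-to-start : ∀ j → fst₃ (s 0) ≡ fst₃ (s (suc j)) → ⊥
    returns-to-start j k≡ = never-1 j (trans (sym k≡) starts-at-1)

    -- If the stages i+1 and j+1 agree, then k_i = k_j, and either m_i = m_j or
    -- m_i, m_j are two best members of one class mod k_{i+1}, whence m_i + m_j = 2k_i.
    step-back : ∀ i j → fst₃ (s (suc i)) ≡ fst₃ (s (suc j)) →
                mid₃ (s (suc i)) ≡ mid₃ (s (suc j)) →
                fst₃ (s i) ≡ fst₃ (s j) ×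
                (mid₃ (s i) ≡ mid₃ (s j) ⊎ mid₃ (s i) + mid₃ (s j) ≡ 2 * fst₃ (s i))
    step-back i j k≡ w≡ = k-equal , choices
      where
      k = fst₃ (s (suc i))
      w = mid₃ (s (suc i))
      a = mid₃ (s i)
      b = mid₃ (s j)
      best-a : BestMod n k a
      best-a = subst (λ z → BestMod n z a) (chained i) (best-after i)
      best-b : BestMod n k b
      best-b = subst (λ z → BestMod n z b) (trans (chained j) (sym k≡)) (best-after j)
      gap-a : gap a ≡ fst₃ (s i) * k
      gap-a = trans (proj₂ (proj₂ (stage i))) (cong (fst₃ (s i) *_) (chained i))
      gap-b : gap b ≡ fst₃ (s j) * k
      gap-b = trans (proj₂ (proj₂ (stage j))) (cong (fst₃ (s j) *_) (trans (chained j) (sym k≡)))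
      -- both a and b are congruent to −w mod k
      b≡a : b ≡ a [mod k ]
      b≡a = subst (k ∣_) (∣m+n-m+o∣≡∣n-o∣ w b a)
              (∣-distance (subst₂ (λ z y → z ∣ y + b) (sym k≡) (sym w≡) (proj₁ (stage (suc j))))
                          (proj₁ (stage (suc i))))
      same-gap : gap a ≡ gap b
      same-gap = ≤-antisym (proj₂ best-a b (proj₁ best-b) b≡a)
                           (proj₂ best-b a (proj₁ best-a) (subst (k ∣_) (∣-∣-comm b a) b≡a))
      k>0 : 0 < k
      k>0 = proj₂ (gap-factors-pos {a} {fst₃ (s i)} {k} gap-a)
      k-equal : fst₃ (s i) ≡ fst₃ (s j)
      k-equal = *-cancelʳ-≡ _ _ k {{>-nonZero k>0}} (trans (sym gap-a) (trans same-gap gap-b))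
      choices : a ≡ b ⊎ a + b ≡ 2 * fst₃ (s i)
      choices with a ≟ b
      ... | yes a≡b = inj₁ a≡b
      ... | no a≢b  = inj₂ (tie {K = fst₃ (s i)} a≢b best-a best-b b≡a gap-a
                                (trans gap-b (cong (_* k) (sym k-equal))))

    -- Symmetric best choices m_i + m_j = 2k_i at equal multipliers k_i = k_j
    -- make k_i divide m_{i−1} + m_{j−1}, so there is a shortcut.
    symmetric-choices : ∀ i j → i < j → fst₃ (s i) ≡ fst₃ (s j) →
                        mid₃ (s i) + mid₃ (s j) ≡ 2 * fst₃ (s i) → ⊥
    symmetric-choices zero    (suc j) _ k≡ _ = returns-to-start j k≡
    symmetric-choices (suc i) (suc j) _ k≡ a+b≡2k = no-shortcut i j k≡ k∣a'+b'
      where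
      k = fst₃ (s (suc i))
      a = mid₃ (s (suc i))
      b = mid₃ (s (suc j))
      a' = mid₃ (s i)
      b' = mid₃ (s j)
      k∣a+a' : k ∣ a + a'
      k∣a+a' = proj₁ (stage (suc i))
      k∣b+b' : k ∣ b + b'
      k∣b+b' = subst (λ z → z ∣ b + b') (sym k≡) (proj₁ (stage (suc j)))
      regroup : ∀ a a' b b' → (a + a') + (b + b') ≡ (a + b) + (a' + b')
      regroup = solve-∀
      k∣a'+b' : k ∣ a' + b'
      k∣a'+b' = ∣m+n∣m⇒∣n (subst (k ∣_) (trans (regroup a a' b b') (cong (_+ (a' + b')) a+b≡2k))
                                     (∣m∣n⇒∣m+n k∣a+a' k∣b+b'))
                          (divides 2 refl)

    no-repeat : ∀ i j → i < j → fst₃ (s i) ≡ fst₃ (s j) → mid₃ (s i) ≡ mid₃ (s j) → ⊥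
    no-repeat zero    (suc j) _ k≡ _ = returns-to-start j k≡
    no-repeat (suc i) (suc j) (s≤s i<j) k≡ m≡ with step-back i j k≡ m≡
    ... | k≡' , inj₁ m≡'   = no-repeat i j i<j k≡' m≡'
    ... | k≡' , inj₂ a+b≡2k = symmetric-choices i j i<j k≡' a+b≡2k

    -- All stages lie in {0..n}², so by the pigeonhole principle one repeats.
    stage-bounded : ∀ i → fst₃ (s i) ≤ n × mid₃ (s i) ≤ n
    stage-bounded i =
      two-sided-bounded (proj₂ (gap-factors-pos {mid₃ (s i)} {fst₃ (s i)} {lst₃ (s i)} gm))
                        (proj₁ bm) (two-sided gm bm (best-after i))
      where
      bm = proj₁ (proj₂ (stage i))
      gm = proj₂ (proj₂ (stage i))

    code : ℕ → Fin (suc n * suc n)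
    code i = combine (fromℕ< (s≤s (proj₁ (stage-bounded i))))
                     (fromℕ< (s≤s (proj₂ (stage-bounded i))))

    impossible-run : ⊥
    impossible-run with pigeonhole (n<1+n (suc n * suc n)) (λ x → code (toℕ x))
    ... | i , j , i<j , same-code with combine-injective _ _ _ _ same-code
    ...   | k-code≡ , m-code≡ =
      no-repeat (toℕ i) (toℕ j) i<j (fromℕ<-injective _ _ _ _ k-code≡)
                                    (fromℕ<-injective _ _ _ _ m-code≡)

proposition3 : (n : ℕ) → 0 < n → NonSquare n →
    (s : Defs.Seq) → Produced n s →
    (∀ t → Produced n t → t ≈ˢ s) →
    FiniteSymmetric s
proposition3 n n>0 nonsquare (fin l) run unique =
  l , refl , palindrome l (unique (fin _) (reverse-run run start))
  where open Runs n n>0 nonsquare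
proposition3 n n>0 nonsquare (inf s) run unique = ⊥-elim impossible-run
  where open Runs.Infinite n n>0 nonsquare s run unique
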